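{- For every $n\in\mathbb{N}$, the probability that a uniformly random vector from $\{1,\ldots,n\}^{5n}$ does not cover the vector $(n,\ldots,1)$ is at most $0.044$.
   Context: For $m\ge n$ and $v\in\{1,\ldots,n\}^m$, let $v^\star$ be the vector with the same entries as $v$ sorted in non-increasing order. $v$ covers $(n,\ldots,1)$ if $v^\star_i\ge n-i+1$ for all $i\in\{1,\ldots,n\}$. -}

module Defs where

open import Data.Nat using (ℕ; zero; suc; _∸_; _≤_; _≤?_)
open import Data.Bool using (if_then_else_)
open import Data.List using (List; []; _∷_; map; concatMap; upTo; length; filter)
open import Data.List.Relation.Unary.All using (All; all?)
open import Relation.Nullary using (Dec; ¬?)
open import Relation.Nullary.Decidable using (does)

allVecs : ℕ → ℕ → List (List ℕ)
allVecs zero    n = [] ∷ []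
allVecs (suc m) n = concatMap (λ k → map (suc k ∷_) (allVecs m n)) (upTo n)

insertDesc : ℕ → List ℕ → List ℕ
insertDesc x []       = x ∷ []
insertDesc x (y ∷ ys) = if does (y ≤? x) then x ∷ y ∷ ys else y ∷ insertDesc x ys

sortDesc : List ℕ → List ℕ
sortDesc []       = []
sortDesc (x ∷ xs) = insertDesc x (sortDesc xs)

-- 0-based indexing, default 0 out of range (never used when m ≥ n).
nth : List ℕ → ℕ → ℕ
nth []       _       = 0
nth (x ∷ xs) zero    = x
nth (x ∷ xs) (suc i) = nth xs i

-- v covers (n,…,1): with v⋆ = sortDesc v, v⋆_i ≥ n - i + 1 for i = 1..n
-- (0-based: v⋆[i] ≥ n ∸ i for i = 0..n-1).
Covers : ℕ → List ℕ → Set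
Covers n v = All (λ i → n ∸ i ≤ nth (sortDesc v) i) (upTo n)

covers? : (n : ℕ) (v : List ℕ) → Dec (Covers n v)
covers? n v = all? (λ i → n ∸ i ≤? nth (sortDesc v) i) (upTo n)

nonCovering : ℕ → ℕ → ℕ
nonCovering m n = length (filter (λ v → ¬? (covers? n v)) (allVecs m n))

module Submission where

-- An exponential-moment (Markov) bound. Write t = n ∸ (1 + i). If v fails the covering condition
-- at position i, its (i+1)-st largest entry is at most t, so at most i entries of v exceed t;
-- giving every entry ≤ t the weight 5 and every other entry the weight 1 then gives
-- 5^m ≤ 5^i · ∏ⱼ w_t(vⱼ). Summed over all v the product weights factor:
-- Σ_v ∏ⱼ w_t(vⱼ) = (n + 4t)^m. For m = 5n and r = i + 1, Bernoulli's inequality together with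
-- (1 − 1/M)^M ≤ 2/5 gives ((n + 4t)/(5n))^(5n) ≤ (2/5)^(4r) < 35^(−r), so the failure
-- probability is at most Σᵢ 5^i / 35^(i+1) = Σᵢ 1 / (5 · 7^(i+1)) ≤ 1/30 < 0.044.

open import Defs
open import Data.Bool using (true; false; if_then_else_)
open import Data.List using (List; []; _∷_; _++_; map; length; filter; concat; applyUpTo; upTo)
open import Data.List.Properties using (map-upTo; map-++; map-∘; map-cong)
open import Data.List.Relation.Unary.All as All using (All; []; _∷_)
open import Data.List.Relation.Unary.All.Properties using (¬All⇒Any¬; concat⁺; map⁺)
open import Data.List.Relation.Unary.AllPairs using (AllPairs; []; _∷_)
open import Data.List.Relation.Unary.Any using (Any; here; there)
open import Data.List.Relation.Binary.Permutation.Propositional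
  using (_↭_; ↭-refl; ↭-prep; ↭-swap; ↭-trans; ↭-sym)
open import Data.List.Relation.Binary.Permutation.Propositional.Properties
  using (All-resp-↭; ↭-length) renaming (map⁺ to ↭-map⁺)
open import Data.Nat
open import Data.Nat.ListAction using (sum; product)
open import Data.Nat.ListAction.Properties using (sum-++; product-↭)
open import Data.Nat.Properties
open import Algebra.Properties.CommutativeSemigroup *-commutativeSemigroup using (x∙yz≈y∙xz)
open import Algebra.Properties.CommutativeSemigroup +-commutativeSemigroup
  using () renaming (interchange to +-interchange)
open import Data.Nat.Tactic.RingSolver using (solve-∀)
open import Function using (_∘_)
open import Relation.Binary.PropositionalEquality
open import Relation.Nullary using (¬_; yes; no; ¬?)
open import Relation.Nullary.Reflects using (ofʸ; ofⁿ)
open import Relation.Unary using (Decidable)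

insertDesc-↭ : ∀ x ys → insertDesc x ys ↭ x ∷ ys
insertDesc-↭ x []       = ↭-refl
insertDesc-↭ x (y ∷ ys) with y ≤ᵇ x
... | true  = ↭-refl
... | false = ↭-trans (↭-prep y (insertDesc-↭ x ys)) (↭-swap y x ↭-refl)

sortDesc-↭ : ∀ v → sortDesc v ↭ v
sortDesc-↭ []      = ↭-refl
sortDesc-↭ (x ∷ v) = ↭-trans (insertDesc-↭ x (sortDesc v)) (↭-prep x (sortDesc-↭ v))

insertDesc-descending : ∀ x {ys} → AllPairs _≥_ ys → AllPairs _≥_ (insertDesc x ys)
insertDesc-descending x {[]}     []           = [] ∷ []
insertDesc-descending x {y ∷ ys} (y≥ys ∷ ys↓) with y ≤ᵇ x | ≤ᵇ-reflects-≤ y x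
... | true  | ofʸ y≤x = (y≤x ∷ All.map (λ z≤y → ≤-trans z≤y y≤x) y≥ys) ∷ y≥ys ∷ ys↓
... | false | ofⁿ y≰x =
  All-resp-↭ (↭-sym (insertDesc-↭ x ys)) (<⇒≤ (≰⇒> y≰x) ∷ y≥ys) ∷ insertDesc-descending x ys↓

sortDesc-descending : ∀ v → AllPairs _≥_ (sortDesc v)
sortDesc-descending []      = []
sortDesc-descending (x ∷ v) = insertDesc-descending x (sortDesc-descending v)

Any⇒≤sum : ∀ {A : Set} {P : A → Set} {c} (f : A → ℕ) {xs} →
           (∀ {x} → P x → c ≤ f x) → Any P xs → c ≤ sum (map f xs)
Any⇒≤sum f bound (here px)   = ≤-trans (bound px) (m≤m+n _ _)
Any⇒≤sum f bound (there pxs) = ≤-trans (Any⇒≤sum f bound pxs) (m≤n+m _ _)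

*-length-filter≤sum : ∀ {A : Set} {P : A → Set} (P? : Decidable P) {c} (g : A → ℕ) {xs} →
                      All (λ x → P x → c ≤ g x) xs → c * length (filter P? xs) ≤ sum (map g xs)
*-length-filter≤sum P? {c} g []                         = ≤-reflexive (*-zeroʳ c)
*-length-filter≤sum P? {c} g {x ∷ xs} (bound ∷ bounds) with P? x
... | yes px = ≤-trans (≤-reflexive (*-suc c _))
                       (+-mono-≤ (bound px) (*-length-filter≤sum P? g bounds))
... | no  _  = ≤-trans (*-length-filter≤sum P? g bounds) (m≤n+m _ _)

sum-map-0 : ∀ {A : Set} (xs : List A) → sum (map (λ _ → 0) xs) ≡ 0
sum-map-0 []       = refl
sum-map-0 (_ ∷ xs) = sum-map-0 xs

sum-map-+ : ∀ {A : Set} (f g : A → ℕ) xs →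
            sum (map (λ x → f x + g x) xs) ≡ sum (map f xs) + sum (map g xs)
sum-map-+ f g []       = refl
sum-map-+ f g (x ∷ xs) =
  trans (cong (f x + g x +_) (sum-map-+ f g xs)) (+-interchange (f x) (g x) _ _)

sum-map-*ˡ : ∀ {A : Set} c (f : A → ℕ) xs → sum (map (λ x → c * f x) xs) ≡ c * sum (map f xs)
sum-map-*ˡ c f []       = sym (*-zeroʳ c)
sum-map-*ˡ c f (x ∷ xs) =
  trans (cong (c * f x +_) (sum-map-*ˡ c f xs)) (sym (*-distribˡ-+ c (f x) _))

sum-map-*ʳ : ∀ {A : Set} c (f : A → ℕ) xs → sum (map (λ x → f x * c) xs) ≡ sum (map f xs) * c
sum-map-*ʳ c f []       = refl
sum-map-*ʳ c f (x ∷ xs) =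
  trans (cong (f x * c +_) (sum-map-*ʳ c f xs)) (sym (*-distribʳ-+ c (f x) _))

sum-map-concat : ∀ {A : Set} (g : A → ℕ) xss →
                 sum (map g (concat xss)) ≡ sum (map (λ xs → sum (map g xs)) xss)
sum-map-concat g []         = refl
sum-map-concat g (xs ∷ xss) = begin
  sum (map g (xs ++ concat xss))             ≡⟨ cong sum (map-++ g xs (concat xss)) ⟩
  sum (map g xs ++ map g (concat xss))       ≡⟨ sum-++ (map g xs) _ ⟩
  sum (map g xs) + sum (map g (concat xss))  ≡⟨ cong (sum (map g xs) +_) (sum-map-concat g xss) ⟩
  sum (map g xs) + sum (map (λ ys → sum (map g ys)) xss) ∎
  where open ≡-Reasoning

sum-applyUpTo-comm : ∀ {A : Set} (h : ℕ → A → ℕ) n xs →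
                     sum (map (λ x → sum (applyUpTo (λ i → h i x) n)) xs)
                       ≡ sum (applyUpTo (λ i → sum (map (h i) xs)) n)
sum-applyUpTo-comm h zero    xs = sum-map-0 xs
sum-applyUpTo-comm h (suc n) xs =
  trans (sum-map-+ (h 0) _ xs) (cong (sum (map (h 0) xs) +_) (sum-applyUpTo-comm (h ∘ suc) n xs))

-- Σᵢ q^-(i+1) ≤ 1/p for the ratio q = 1 + p.
geometric-bound : ∀ k p X (h : ℕ → ℕ) R → (∀ i → i < R → k * suc p ^ suc i * h i ≤ X) →
                  k * p * sum (applyUpTo h R) ≤ X
geometric-bound k p X h zero    _     = subst (_≤ X) (sym (*-zeroʳ (k * p))) z≤n
geometric-bound k p X h (suc R) bound = *-cancelˡ-≤ (suc p) (begin
  suc p * (k * p * (h 0 + S))                      ≡⟨ rearrange k p (h 0) S ⟩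
  p * (k * (suc p * 1) * h 0) + k * suc p * p * S  ≤⟨ +-mono-≤ (*-monoʳ-≤ p (bound 0 z<s)) tail ⟩
  p * X + X                                        ≡⟨ +-comm (p * X) X ⟩
  suc p * X                                        ∎)
  where
    open ≤-Reasoning
    S = sum (applyUpTo (h ∘ suc) R)
    tail : k * suc p * p * S ≤ X
    tail = geometric-bound (k * suc p) p X (h ∘ suc) R λ i i<R →
      subst (_≤ X) (cong (_* h (suc i)) (sym (*-assoc k (suc p) _))) (bound (suc i) (s<s i<R))
    rearrange : ∀ k p h₀ S → suc p * (k * p * (h₀ + S)) ≡ p * (k * (suc p * 1) * h₀) + k * suc p * p * S
    rearrange = solve-∀

allVecs-length : ∀ m n → All (λ v → length v ≡ m) (allVecs m n)
allVecs-length zero    n = refl ∷ []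
allVecs-length (suc m) n =
  concat⁺ (map⁺ (All.universal (λ k → map⁺ (All.map (cong suc) (allVecs-length m n))) (upTo n)))

sum-product-allVecs : ∀ (f : ℕ → ℕ) m n →
                      sum (map (λ v → product (map f v)) (allVecs m n)) ≡ sum (applyUpTo (f ∘ suc) n) ^ m
sum-product-allVecs f zero    n = refl
sum-product-allVecs f (suc m) n = begin
  sum (map P (concat (map (λ k → map (suc k ∷_) V) (upTo n))))
    ≡⟨ sum-map-concat P (map (λ k → map (suc k ∷_) V) (upTo n)) ⟩
  sum (map (λ vs → sum (map P vs)) (map (λ k → map (suc k ∷_) V) (upTo n)))
    ≡⟨ cong sum (sym (map-∘ (upTo n))) ⟩
  sum (map (λ k → sum (map P (map (suc k ∷_) V))) (upTo n))
    ≡⟨ cong sum (map-cong row (upTo n)) ⟩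
  sum (map (λ k → f (suc k) * sum (map P V)) (upTo n))
    ≡⟨ sum-map-*ʳ (sum (map P V)) (f ∘ suc) (upTo n) ⟩
  sum (map (f ∘ suc) (upTo n)) * sum (map P V)
    ≡⟨ cong₂ _*_ (cong sum (map-upTo (f ∘ suc) n)) (sum-product-allVecs f m n) ⟩
  sum (applyUpTo (f ∘ suc) n) * sum (applyUpTo (f ∘ suc) n) ^ m ∎
  where
    open ≡-Reasoning
    V = allVecs m n
    P : List ℕ → ℕ
    P v = product (map f v)
    row : ∀ k → sum (map P (map (suc k ∷_) V)) ≡ f (suc k) * sum (map P V)
    row k = trans (cong sum (sym (map-∘ V))) (sum-map-*ˡ (f (suc k)) P V)

entryWeight : ℕ → ℕ → ℕ
entryWeight t x = if x ≤ᵇ t then 5 else 1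

weight : ℕ → List ℕ → ℕ
weight t v = product (map (entryWeight t) v)

entryWeight-≤ : ∀ {t x} → x ≤ t → entryWeight t x ≡ 5
entryWeight-≤ {t} {x} x≤t with x ≤ᵇ t | ≤⇒≤ᵇ x≤t
... | true | _ = refl

entryWeight-nonZero : ∀ t x → NonZero (entryWeight t x)
entryWeight-nonZero t x with x ≤ᵇ t
... | true  = _
... | false = _

weight-All≤ : ∀ {t v} → All (_≤ t) v → weight t v ≡ 5 ^ length v
weight-All≤ []          = refl
weight-All≤ (x≤t ∷ v≤t) = cong₂ _*_ (entryWeight-≤ x≤t) (weight-All≤ v≤t)

weight-↭ : ∀ t {u v} → u ↭ v → weight t u ≡ weight t v
weight-↭ t u↭v = product-↭ (↭-map⁺ (entryWeight t) u↭v)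

sum-entryWeight≤ : ∀ t n → sum (applyUpTo (entryWeight t ∘ suc) n) ≤ n + 4 * t
sum-entryWeight≤ t       zero    = z≤n
sum-entryWeight≤ zero    (suc n) = s≤s (sum-entryWeight≤ zero n)
sum-entryWeight≤ (suc t) (suc n) = begin
  5 + sum (applyUpTo (entryWeight t ∘ suc) n)  ≤⟨ +-monoʳ-≤ 5 (sum-entryWeight≤ t n) ⟩
  5 + (n + 4 * t)                              ≡⟨ rearrange n t ⟩
  suc n + 4 * suc t                            ∎
  where
    open ≤-Reasoning
    rearrange : ∀ n t → 5 + (n + 4 * t) ≡ suc n + 4 * suc t
    rearrange = solve-∀

descending⇒5^length≤5^i*weight : ∀ {t s} i → AllPairs _≥_ s → nth s i ≤ t →
                                  5 ^ length s ≤ 5 ^ i * weight t s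
descending⇒5^length≤5^i*weight {s = []} i [] _ =
  ≤-trans (^-monoʳ-≤ 5 {0} {i} z≤n) (≤-reflexive (sym (*-identityʳ (5 ^ i))))
descending⇒5^length≤5^i*weight {t} {x ∷ s} zero (x≥s ∷ _) x≤t = ≤-reflexive (begin
  5 ^ length (x ∷ s)      ≡⟨ weight-All≤ (x≤t ∷ All.map (λ y≤x → ≤-trans y≤x x≤t) x≥s) ⟨
  weight t (x ∷ s)        ≡⟨ +-identityʳ _ ⟨
  1 * weight t (x ∷ s)    ∎)
  where open ≡-Reasoning
descending⇒5^length≤5^i*weight {t} {x ∷ s} (suc i) (_ ∷ s↓) sᵢ≤t = begin
  5 * 5 ^ length s                              ≤⟨ *-monoʳ-≤ 5 (descending⇒5^length≤5^i*weight i s↓ sᵢ≤t) ⟩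
  5 * (5 ^ i * weight t s)                      ≤⟨ *-monoʳ-≤ 5 (*-monoʳ-≤ (5 ^ i) weight≤) ⟩
  5 * (5 ^ i * (entryWeight t x * weight t s))  ≡⟨ *-assoc 5 (5 ^ i) _ ⟨
  5 ^ suc i * weight t (x ∷ s)                  ∎
  where
    open ≤-Reasoning
    weight≤ : weight t s ≤ entryWeight t x * weight t s
    weight≤ = m≤n*m _ _ {{entryWeight-nonZero t x}}

nth-sortDesc⇒5^length≤5^i*weight : ∀ {t} v i → nth (sortDesc v) i ≤ t →
                                    5 ^ length v ≤ 5 ^ i * weight t v
nth-sortDesc⇒5^length≤5^i*weight {t} v i v⋆ᵢ≤t =
  subst₂ (λ l w → 5 ^ l ≤ 5 ^ i * w) (↭-length v⋆↭v) (weight-↭ t v⋆↭v)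
    (descending⇒5^length≤5^i*weight i (sortDesc-descending v) v⋆ᵢ≤t)
  where v⋆↭v = sortDesc-↭ v

failureTerm : ℕ → ℕ → List ℕ → ℕ
failureTerm n i v = 5 ^ i * weight (n ∸ suc i) v

failureWeight : ℕ → List ℕ → ℕ
failureWeight n v = sum (applyUpTo (λ i → failureTerm n i v) n)

¬Covers⇒5^length≤failureWeight : ∀ n v → ¬ Covers n v → 5 ^ length v ≤ failureWeight n v
¬Covers⇒5^length≤failureWeight n v ¬cover =
  subst (5 ^ length v ≤_) (cong sum (map-upTo (λ i → failureTerm n i v) n))
    (Any⇒≤sum (λ i → failureTerm n i v) gap⇒bound
      (¬All⇒Any¬ (λ i → n ∸ i ≤? nth (sortDesc v) i) (upTo n) ¬cover))
  where
    gap⇒bound : ∀ {i} → ¬ (n ∸ i ≤ nth (sortDesc v) i) → 5 ^ length v ≤ failureTerm n i v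
    gap⇒bound {i} gap = nth-sortDesc⇒5^length≤5^i*weight v i
      (subst (nth (sortDesc v) i ≤_) (pred[m∸n]≡m∸[1+n] n i) (pred-mono-≤ (≰⇒> gap)))

5^m*nonCovering≤sum-failureWeight : ∀ m n →
                                    5 ^ m * nonCovering m n ≤ sum (map (failureWeight n) (allVecs m n))
5^m*nonCovering≤sum-failureWeight m n =
  *-length-filter≤sum (λ v → ¬? (covers? n v)) (failureWeight n)
    (All.map (λ {v} → bound {v}) (allVecs-length m n))
  where
    bound : ∀ {v} → length v ≡ m → ¬ Covers n v → 5 ^ m ≤ failureWeight n v
    bound {v} length≡m ¬cover =
      subst (λ l → 5 ^ l ≤ failureWeight n v) length≡m (¬Covers⇒5^length≤failureWeight n v ¬cover)

^-distribʳ-* : ∀ m n o → (m * n) ^ o ≡ m ^ o * n ^ o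
^-distribʳ-* m n zero    = refl
^-distribʳ-* m n (suc o) =
  trans (cong (m * n *_) (^-distribʳ-* m n o)) ([m*n]*[o*p]≡[m*o]*[n*p] m n _ _)

^-^-comm : ∀ m n o → (m ^ n) ^ o ≡ (m ^ o) ^ n
^-^-comm m n o = begin
  (m ^ n) ^ o  ≡⟨ ^-*-assoc m n o ⟩
  m ^ (n * o)  ≡⟨ cong (m ^_) (*-comm n o) ⟩
  m ^ (o * n)  ≡⟨ ^-*-assoc m o n ⟨
  (m ^ o) ^ n  ∎
  where open ≡-Reasoning

-- Bernoulli's inequality (1 − 1/M)^j ≥ 1 − j/M for M = a + 1, with denominators cleared.
bernoulli : ∀ a b j → b + j ≡ suc a → b * suc a ^ j ≤ suc a * a ^ j
bernoulli a b zero    b+0≡M = ≤-reflexive (cong (_* 1) (trans (sym (+-identityʳ b)) b+0≡M))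
bernoulli a b (suc j) b+j≡M = begin
  b * (suc a * suc a ^ j)  ≡⟨ *-assoc b (suc a) _ ⟨
  b * suc a * suc a ^ j    ≤⟨ *-monoˡ-≤ (suc a ^ j) b[1+a]≤a[1+b] ⟩
  a * suc b * suc a ^ j    ≡⟨ *-assoc a (suc b) _ ⟩
  a * (suc b * suc a ^ j)  ≤⟨ *-monoʳ-≤ a (bernoulli a (suc b) j (trans (sym (+-suc b j)) b+j≡M)) ⟩
  a * (suc a * a ^ j)      ≡⟨ x∙yz≈y∙xz a (suc a) _ ⟩
  suc a * (a * a ^ j)      ∎
  where
    open ≤-Reasoning
    b≤a : b ≤ a
    b≤a = s≤s⁻¹ (subst (b <_) b+j≡M (m<m+n b z<s))
    b[1+a]≤a[1+b] : b * suc a ≤ a * suc b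
    b[1+a]≤a[1+b] = begin
      b * suc a  ≡⟨ *-suc b a ⟩
      b + b * a  ≤⟨ +-monoˡ-≤ (b * a) b≤a ⟩
      a + b * a  ≡⟨ cong (a +_) (*-comm b a) ⟩
      a + a * b  ≡⟨ *-suc a b ⟨
      a * suc b  ∎

choose₂ : ℕ → ℕ
choose₂ zero    = 0
choose₂ (suc m) = m + choose₂ m

2*choose₂[1+m]≡[1+m]*m : ∀ m → 2 * choose₂ (suc m) ≡ suc m * m
2*choose₂[1+m]≡[1+m]*m zero    = refl
2*choose₂[1+m]≡[1+m]*m (suc m) = begin
  2 * (suc m + (m + choose₂ m))    ≡⟨ *-distribˡ-+ 2 (suc m) _ ⟩
  2 * suc m + 2 * choose₂ (suc m)  ≡⟨ cong (2 * suc m +_) (2*choose₂[1+m]≡[1+m]*m m) ⟩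
  2 * suc m + suc m * m            ≡⟨ rearrange m ⟩
  suc (suc m) * suc m              ∎
  where
    open ≡-Reasoning
    rearrange : ∀ m → 2 * suc m + suc m * m ≡ suc (suc m) * suc m
    rearrange = solve-∀

-- (1 + 1/a)^m ≥ 1 + m/a + C(m,2)/a², with denominators cleared.
binomial-lower-bound : ∀ a m → a ^ m * (a * a + m * a + choose₂ m) ≤ a * a * suc a ^ m
binomial-lower-bound a zero    = ≤-reflexive (rearrange a)
  where
    rearrange : ∀ a → 1 * (a * a + 0 * a + 0) ≡ a * a * 1
    rearrange = solve-∀
binomial-lower-bound a (suc m) = begin
  a * x * (a * a + suc m * a + (m + c))                ≡⟨ rearrange a x m c ⟩
  x * (a * a + m * a) + a * (x * (a * a + m * a + c))  ≤⟨ +-monoˡ-≤ _ (*-monoʳ-≤ x (m≤m+n _ c)) ⟩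
  suc a * (x * (a * a + m * a + c))                    ≤⟨ *-monoʳ-≤ (suc a) (binomial-lower-bound a m) ⟩
  suc a * (a * a * suc a ^ m)                          ≡⟨ x∙yz≈y∙xz (suc a) (a * a) _ ⟩
  a * a * (suc a * suc a ^ m)                          ∎
  where
    open ≤-Reasoning
    x = a ^ m
    c = choose₂ m
    rearrange : ∀ a x m c → a * x * (a * a + suc m * a + (m + c))
                              ≡ x * (a * a + m * a) + a * (x * (a * a + m * a + c))
    rearrange = solve-∀

-- (1 − 1/M)^M ≤ 2/5 for M = a + 1.
5*a^[1+a]≤2*[1+a]^[1+a] : ∀ a → 5 * a ^ suc a ≤ 2 * suc a ^ suc a
5*a^[1+a]≤2*[1+a]^[1+a] zero      = z≤n
5*a^[1+a]≤2*[1+a]^[1+a] a@(suc _) = *-cancelˡ-≤ (a * a) (begin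
  a * a * (5 * y)                                 ≤⟨ m≤m+n _ (3 * a * y) ⟩
  a * a * (5 * y) + 3 * a * y                     ≡⟨ expand a y ⟩
  y * (2 * s + suc a * a)                         ≡⟨ cong (λ z → y * (2 * s + z)) (2*choose₂[1+m]≡[1+m]*m a) ⟨
  y * (2 * s + 2 * choose₂ (suc a))               ≡⟨ factor y s (choose₂ (suc a)) ⟩
  2 * (y * (s + choose₂ (suc a)))                 ≤⟨ *-monoʳ-≤ 2 (binomial-lower-bound a (suc a)) ⟩
  2 * (a * a * suc a ^ suc a)                     ≡⟨ x∙yz≈y∙xz 2 (a * a) (suc a ^ suc a) ⟩
  a * a * (2 * suc a ^ suc a)                     ∎)
  where
    open ≤-Reasoning
    y = a ^ suc a
    s = a * a + suc a * a
    expand : ∀ a y → a * a * (5 * y) + 3 * a * y ≡ y * (2 * (a * a + suc a * a) + suc a * a)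
    expand = solve-∀
    factor : ∀ y s c → y * (2 * s + 2 * c) ≡ 2 * (y * (s + c))
    factor = solve-∀

5^j*b^[1+a]≤2^j*[1+a]^[1+a] : ∀ a b j → b + j ≡ suc a → 5 ^ j * b ^ suc a ≤ 2 ^ j * suc a ^ suc a
5^j*b^[1+a]≤2^j*[1+a]^[1+a] a b j b+j≡M =
  *-cancelʳ-≤ _ _ ((M ^ M) ^ j) {{m^n≢0 (M ^ M) j {{m^n≢0 M M}}}} (begin
    5 ^ j * b ^ M * (M ^ M) ^ j    ≡⟨ *-assoc (5 ^ j) (b ^ M) _ ⟩
    5 ^ j * (b ^ M * (M ^ M) ^ j)  ≡⟨ cong (5 ^ j *_) (split b) ⟨
    5 ^ j * (b * M ^ j) ^ M        ≤⟨ *-monoʳ-≤ (5 ^ j) (^-monoˡ-≤ M (bernoulli a b j b+j≡M)) ⟩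
    5 ^ j * (M * a ^ j) ^ M        ≡⟨ cong (5 ^ j *_) (trans (^-distribʳ-* M (a ^ j) M)
                                                             (cong (M ^ M *_) (^-^-comm a j M))) ⟩
    5 ^ j * (M ^ M * (a ^ M) ^ j)  ≡⟨ x∙yz≈y∙xz (5 ^ j) (M ^ M) _ ⟩
    M ^ M * (5 ^ j * (a ^ M) ^ j)  ≡⟨ cong (M ^ M *_) (^-distribʳ-* 5 (a ^ M) j) ⟨
    M ^ M * (5 * a ^ M) ^ j        ≤⟨ *-monoʳ-≤ (M ^ M) (^-monoˡ-≤ j (5*a^[1+a]≤2*[1+a]^[1+a] a)) ⟩
    M ^ M * (2 * M ^ M) ^ j        ≡⟨ cong (M ^ M *_) (^-distribʳ-* 2 (M ^ M) j) ⟩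
    M ^ M * (2 ^ j * (M ^ M) ^ j)  ≡⟨ x∙yz≈y∙xz (M ^ M) (2 ^ j) _ ⟩
    2 ^ j * (M ^ M * (M ^ M) ^ j)  ≡⟨ *-assoc (2 ^ j) (M ^ M) _ ⟨
    2 ^ j * M ^ M * (M ^ M) ^ j    ∎)
  where
    open ≤-Reasoning
    M = suc a
    split : ∀ x → (x * M ^ j) ^ M ≡ x ^ M * (M ^ M) ^ j
    split x = trans (^-distribʳ-* x (M ^ j) M) (cong (x ^ M *_) (^-^-comm M j M))

35^r*b^[1+a]≤[1+a]^[1+a] : ∀ a b r → b + 4 * r ≡ suc a → 35 ^ r * b ^ suc a ≤ suc a ^ suc a
35^r*b^[1+a]≤[1+a]^[1+a] a b r b+4r≡M = *-cancelˡ-≤ (16 ^ r) {{m^n≢0 16 r}} (begin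
  16 ^ r * (35 ^ r * b ^ M)  ≡⟨ *-assoc (16 ^ r) (35 ^ r) _ ⟨
  16 ^ r * 35 ^ r * b ^ M    ≡⟨ cong (_* b ^ M) (^-distribʳ-* 16 35 r) ⟨
  560 ^ r * b ^ M            ≤⟨ *-monoˡ-≤ (b ^ M) (^-monoˡ-≤ r (m≤m+n 560 65)) ⟩
  625 ^ r * b ^ M            ≡⟨ cong (_* b ^ M) (^-*-assoc 5 4 r) ⟩
  5 ^ (4 * r) * b ^ M        ≤⟨ 5^j*b^[1+a]≤2^j*[1+a]^[1+a] a b (4 * r) b+4r≡M ⟩
  2 ^ (4 * r) * M ^ M        ≡⟨ cong (_* M ^ M) (^-*-assoc 2 4 r) ⟨
  16 ^ r * M ^ M             ∎)
  where
    open ≤-Reasoning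
    M = suc a

5*7^[1+i]*sum-failureTerm≤[5n]^[5n] : ∀ n i → i < n →
  5 * 7 ^ suc i * sum (map (failureTerm n i) (allVecs (5 * n) n)) ≤ (5 * n) ^ (5 * n)
5*7^[1+i]*sum-failureTerm≤[5n]^[5n] n@(suc n′) i i<n = begin
  5 * 7 ^ suc i * sum (map (failureTerm n i) (allVecs M n))
    ≡⟨ cong (5 * 7 ^ suc i *_) (trans (sum-map-*ˡ (5 ^ i) (weight t) (allVecs M n))
                                      (cong (5 ^ i *_) (sum-product-allVecs (entryWeight t) M n))) ⟩
  5 * 7 ^ suc i * (5 ^ i * sum (applyUpTo (entryWeight t ∘ suc) n) ^ M)
    ≤⟨ *-monoʳ-≤ (5 * 7 ^ suc i) (*-monoʳ-≤ (5 ^ i) (^-monoˡ-≤ M (sum-entryWeight≤ t n))) ⟩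
  5 * 7 ^ suc i * (5 ^ i * (n + 4 * t) ^ M)
    ≡⟨ trans (cong (_* (n + 4 * t) ^ M) (^-distribʳ-* 5 7 (suc i))) (regroup (5 ^ i) (7 ^ i) _) ⟨
  35 ^ suc i * (n + 4 * t) ^ M
    ≤⟨ 35^r*b^[1+a]≤[1+a]^[1+a] (n′ + 4 * n) (n + 4 * t) (suc i) b+4r≡M ⟩
  M ^ M ∎
  where
    open ≤-Reasoning
    M = 5 * n
    t = n ∸ suc i
    regroup : ∀ p q B → 5 * p * (7 * q) * B ≡ 5 * (7 * q) * (p * B)
    regroup = solve-∀
    factor : ∀ n t s → n + 4 * t + 4 * s ≡ n + 4 * (t + s)
    factor = solve-∀
    n+4n≡5n : ∀ n → n + 4 * n ≡ 5 * n
    n+4n≡5n = solve-∀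
    b+4r≡M : n + 4 * t + 4 * suc i ≡ M
    b+4r≡M = trans (factor n t (suc i)) (trans (cong (λ s → n + 4 * s) (m∸n+n≡m i<n)) (n+4n≡5n n))

30*nonCovering≤ : ∀ n → 30 * nonCovering (5 * n) n ≤ n ^ (5 * n)
30*nonCovering≤ n = *-cancelˡ-≤ (5 ^ M) {{m^n≢0 5 M}} (begin
  5 ^ M * (30 * nonCovering M n)    ≡⟨ x∙yz≈y∙xz (5 ^ M) 30 _ ⟩
  30 * (5 ^ M * nonCovering M n)    ≤⟨ *-monoʳ-≤ 30 (5^m*nonCovering≤sum-failureWeight M n) ⟩
  30 * sum (map (failureWeight n) V)
    ≡⟨ cong (30 *_) (sum-applyUpTo-comm (failureTerm n) n V) ⟩
  30 * sum (applyUpTo (λ i → sum (map (failureTerm n i) V)) n)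
    ≤⟨ geometric-bound 5 6 _ _ n (5*7^[1+i]*sum-failureTerm≤[5n]^[5n] n) ⟩
  (5 * n) ^ M                       ≡⟨ ^-distribʳ-* 5 n M ⟩
  5 ^ M * n ^ M                     ∎)
  where
    open ≤-Reasoning
    M = 5 * n
    V = allVecs M n

corollary2 : (n : ℕ) → 1000 * nonCovering (5 * n) n ≤ 44 * n ^ (5 * n)
corollary2 n = begin
  1000 * nonCovering (5 * n) n       ≤⟨ *-monoˡ-≤ (nonCovering (5 * n) n) (m≤m+n 1000 320) ⟩
  44 * 30 * nonCovering (5 * n) n    ≡⟨ *-assoc 44 30 (nonCovering (5 * n) n) ⟩
  44 * (30 * nonCovering (5 * n) n)  ≤⟨ *-monoʳ-≤ 44 (30*nonCovering≤ n) ⟩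
  44 * n ^ (5 * n)                   ∎
  where open ≤-Reasoning
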